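{- For every odd prime $p$, $\chi_a(\mathcal{U}(\mathbb{Z}_{2p})) = p$.
   Context: For a finite ring $R$ with unity and unit group $R^*$, the unitary addition Cayley graph $\mathcal{U}(R)$ is the simple graph with vertex set $R$ in which distinct vertices $x,y$ are adjacent if and only if $x+y \in R^*$; $\mathbb{Z}_n$ is the ring of integers modulo $n$. The achromatic number $\chi_a(G)$ of a graph $G$ is the maximum number of colors in a proper vertex coloring of $G$ such that for every pair of distinct color classes there is at least one edge of $G$ joining a vertex of one class to a vertex of the other. -}

module Defs where

open import Data.Nat using (ℕ; _+_; _*_; _≤_)
open import Data.Fin using (Fin; toℕ)
open import Data.Product using (Σ; ∃; _×_; ∃-syntax)
open import Data.Sum using (_⊎_)
open import Relation.Binary.PropositionalEquality using (_≡_; _≢_)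

_≡_[mod_] : ℕ → ℕ → ℕ → Set
a ≡ b [mod n ] = ∃[ k ] ((a ≡ b + k * n) ⊎ (b ≡ a + k * n))

-- The ring ℤ_n is represented by Fin n (residues 0 … n-1).
-- A residue (given by a natural representative a) is a unit of ℤ_n
-- iff it has a multiplicative inverse modulo n.
IsUnitMod : (n : ℕ) → ℕ → Set
IsUnitMod n a = Σ (Fin n) λ b → (a * toℕ b) ≡ 1 [mod n ]

record Graph : Set₁ where
  field
    size : ℕ
    Adj  : Fin size → Fin size → Set

open Graph public

unitaryAdditionCayley : ℕ → Graph
unitaryAdditionCayley n = record
  { size = n
  ; Adj  = λ x y → (x ≢ y) × IsUnitMod n (toℕ x + toℕ y)
  }

record CompleteColoring (G : Graph) (k : ℕ) : Set where
  field
    color    : Fin (size G) → Fin k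
    onto     : ∀ (i : Fin k) → ∃[ x ] (color x ≡ i)
    proper   : ∀ x y → Adj G x y → color x ≢ color y
    complete : ∀ (i j : Fin k) → i ≢ j →
               ∃[ x ] ∃[ y ] (color x ≡ i × color y ≡ j × Adj G x y)

AchromaticNumber : Graph → ℕ → Set
AchromaticNumber G k = CompleteColoring G k × (∀ m → CompleteColoring G m → m ≤ k)

{-# OPTIONS --safe #-}
-- In ℤ_{2p} the units are the residues prime to 2 and to p, so for x, y < 2p the sum x + y is a unit
-- iff it is odd and differs from p and 3p. Hence U(ℤ_{2p}) is a crown graph: the complete bipartite
-- graph between even and odd residues minus the perfect matching x ↔ p − x (mod 2p). Giving each
-- matched pair its own color is a complete coloring with p colors. Conversely, in a complete
-- coloring with more than p colors, pigeonhole puts the two ends of a matched pair into distinct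
-- classes; such classes lie within one side each, and each side contains at most one such class, as
-- two of them would not be joined by an edge. Re-choosing the representatives of these two classes
-- to be adjacent and applying pigeonhole again produces an adjacent matched pair, which is absurd.
module Submission where

open import Defs
open import Data.Nat.Base
open import Data.Nat.Properties
open import Data.Nat.Divisibility
open import Data.Nat.DivMod using (_divMod_; DivMod)
open import Data.Nat.Coprimality using (Coprime; coprime-Bézout; coprime-divisor)
open import Data.Nat.GCD using (module Bézout)
open import Data.Nat.Primality
  using (Prime; prime⇒irreducible; prime⇒nonZero; irreducible[2]; ¬prime[1])
open import Data.Nat.Tactic.RingSolver using (solve-∀)
open import Data.Parity.Base using (Parity; 0ℙ; 1ℙ; _⁻¹)
import Data.Parity.Base as ℙ
import Data.Parity.Properties as ℙ
open import Data.Parity.Properties using (p≢p⁻¹; p+p≡0ℙ; p⁻¹+p≡1ℙ; +-homo-+; *-homo-*)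
open import Data.Fin.Base using (Fin; toℕ; fromℕ<)
import Data.Fin.Properties as Fin
open import Data.Fin.Properties using (pigeonhole; toℕ<n; toℕ-fromℕ<; toℕ-injective)
open import Data.Product using (_×_; _,_; proj₁; proj₂; ∃-syntax; ∃₂)
open import Data.Sum using (_⊎_; inj₁; inj₂)
open import Function.Base using (_∘_; case_of_)
open import Function.Bundles using (_⇔_; mk⇔; Equivalence)
open import Function.Construct.Composition using (_⇔-∘_)
open import Relation.Nullary using (¬_; contradiction; yes; no; Dec)
open import Relation.Binary.PropositionalEquality

≢⇒≡⁻¹ : ∀ {s t : Parity} → s ≢ t → s ≡ t ⁻¹
≢⇒≡⁻¹ {0ℙ} {0ℙ} s≢t = contradiction refl s≢t
≢⇒≡⁻¹ {0ℙ} {1ℙ} _   = refl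
≢⇒≡⁻¹ {1ℙ} {0ℙ} _   = refl
≢⇒≡⁻¹ {1ℙ} {1ℙ} s≢t = contradiction refl s≢t

+≡1ℙ⇔≢ : ∀ {s t} → s ℙ.+ t ≡ 1ℙ ⇔ s ≢ t
+≡1ℙ⇔≢ {s} {t} = mk⇔ (λ { s+t≡1 refl → p≢p⁻¹ 0ℙ (trans (sym (p+p≡0ℙ s)) s+t≡1) })
                    (λ s≢t → trans (cong (ℙ._+ t) (≢⇒≡⁻¹ s≢t)) (p⁻¹+p≡1ℙ t))

parity[n*2]≡0ℙ : ∀ n → parity (n * 2) ≡ 0ℙ
parity[n*2]≡0ℙ zero    = refl
parity[n*2]≡0ℙ (suc n) = parity[n*2]≡0ℙ n

⌊n*2/2⌋≡n : ∀ n → ⌊ n * 2 /2⌋ ≡ n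
⌊n*2/2⌋≡n zero    = refl
⌊n*2/2⌋≡n (suc n) = cong suc (⌊n*2/2⌋≡n n)

parity≡0ℙ⇒n≡⌊n/2⌋*2 : ∀ n → parity n ≡ 0ℙ → n ≡ ⌊ n /2⌋ * 2
parity≡0ℙ⇒n≡⌊n/2⌋*2 zero          _    = refl
parity≡0ℙ⇒n≡⌊n/2⌋*2 (suc zero)    ()
parity≡0ℙ⇒n≡⌊n/2⌋*2 (suc (suc n)) even = cong (2 +_) (parity≡0ℙ⇒n≡⌊n/2⌋*2 n even)

parity≡0ℙ⇒2∣ : ∀ {n} → parity n ≡ 0ℙ → 2 ∣ n
parity≡0ℙ⇒2∣ {n} even = divides ⌊ n /2⌋ (parity≡0ℙ⇒n≡⌊n/2⌋*2 n even)

2∤⇔parity≡1ℙ : ∀ {n} → 2 ∤ n ⇔ parity n ≡ 1ℙ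
2∤⇔parity≡1ℙ = mk⇔ (λ 2∤n → ≢⇒≡⁻¹ (2∤n ∘ parity≡0ℙ⇒2∣))
                   (λ { odd (divides q refl) → contradiction (trans (sym (parity[n*2]≡0ℙ q)) odd) λ () })

2∤[m+n]⇔parity≢ : ∀ {m n} → 2 ∤ m + n ⇔ parity m ≢ parity n
2∤[m+n]⇔parity≢ {m} {n} =
  +≡1ℙ⇔≢ ⇔-∘ (mk⇔ (trans (sym (+-homo-+ m n))) (trans (+-homo-+ m n)) ⇔-∘ 2∤⇔parity≡1ℙ)

odd-below-4 : ∀ {k} → k < 4 → parity k ≡ 1ℙ → k ≡ 1 ⊎ k ≡ 3
odd-below-4 {1} _ _ = inj₁ refl
odd-below-4 {3} _ _ = inj₂ refl
odd-below-4 {suc (suc (suc (suc _)))} (s≤s (s≤s (s≤s (s≤s ())))) _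

+-*-cancelʳ : ∀ {n u w} v z → v ≤ z → u + v * n ≡ w + z * n → u ≡ w + (z ∸ v) * n
+-*-cancelʳ {n} {u} {w} v z v≤z eq = +-cancelʳ-≡ (v * n) u (w + (z ∸ v) * n) (begin
  u + v * n                 ≡⟨ eq ⟩
  w + z * n                 ≡⟨ cong (λ t → w + t * n) (m∸n+n≡m v≤z) ⟨
  w + (z ∸ v + v) * n       ≡⟨ cong (w +_) (*-distribʳ-+ n (z ∸ v) v) ⟩
  w + ((z ∸ v) * n + v * n) ≡⟨ +-assoc w _ _ ⟨
  w + (z ∸ v) * n + v * n   ∎)
  where open ≡-Reasoning

≡[mod]-intro : ∀ {n u w} v z → u + v * n ≡ w + z * n → u ≡ w [mod n ]
≡[mod]-intro v z eq with ≤-total v z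
... | inj₁ v≤z = z ∸ v , inj₁ (+-*-cancelʳ v z v≤z eq)
... | inj₂ z≤v = v ∸ z , inj₂ (+-*-cancelʳ z v z≤v (sym eq))

isUnitMod-intro : ∀ {n a} .{{_ : NonZero n}} x v z → a * x + v * n ≡ 1 + z * n → IsUnitMod n a
isUnitMod-intro {n} {a} x v z eq = r , ≡[mod]-intro (a * q + v) z (begin
  a * toℕ r + (a * q + v) * n ≡⟨ lemma a (toℕ r) q v n ⟩
  a * (toℕ r + q * n) + v * n ≡⟨ cong (λ t → a * t + v * n) property ⟨
  a * x + v * n               ≡⟨ eq ⟩
  1 + z * n                   ∎)
  where
  open DivMod (x divMod n) renaming (quotient to q; remainder to r)
  open ≡-Reasoning
  lemma : ∀ a r q v n → a * r + (a * q + v) * n ≡ a * (r + q * n) + v * n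
  lemma = solve-∀

coprime⇒isUnitMod : ∀ {n a} .{{_ : NonZero n}} → Coprime a n → IsUnitMod n a
coprime⇒isUnitMod {n@(suc n-1)} {a} a⊥n with coprime-Bézout a⊥n
... | Bézout.+- x y eq = isUnitMod-intro {a = a} x 0 y (begin
  a * x + 0 ≡⟨ +-identityʳ (a * x) ⟩
  a * x     ≡⟨ *-comm a x ⟩
  x * a     ≡⟨ eq ⟨
  1 + y * n ∎)
  where open ≡-Reasoning
-- Here 1 + x a ≡ y n, so the inverse of a is −x ≡ x (n − 1).
... | Bézout.-+ x y eq = isUnitMod-intro {a = a} (x * n-1) y (a * x) (begin
  a * (x * n-1) + y * n       ≡⟨ cong (a * (x * n-1) +_) eq ⟨
  a * (x * n-1) + (1 + x * a) ≡⟨ lemma a x n-1 ⟩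
  1 + a * x * n               ∎)
  where
  open ≡-Reasoning
  lemma : ∀ a x n-1 → a * (x * n-1) + (1 + x * a) ≡ 1 + a * x * suc n-1
  lemma = solve-∀

isUnitMod⇒coprime : ∀ {n a} → IsUnitMod n a → Coprime a n
isUnitMod⇒coprime {n} (b , k , inj₁ ab≡1+kn) {d} (d∣a , d∣n) = ∣1⇒≡1
  (∣m+n∣m⇒∣n (subst (d ∣_) (trans ab≡1+kn (+-comm 1 (k * n))) (∣m⇒∣m*n (toℕ b) d∣a)) (∣n⇒∣m*n k d∣n))
isUnitMod⇒coprime {n} (b , k , inj₂ 1≡ab+kn) {d} (d∣a , d∣n) = ∣1⇒≡1
  (subst (d ∣_) (sym 1≡ab+kn) (∣m∣n⇒∣m+n (∣m⇒∣m*n (toℕ b) d∣a) (∣n⇒∣m*n k d∣n)))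

coprime[2*p]⇔ : ∀ {p a} → Prime p → Coprime a (2 * p) ⇔ (2 ∤ a × p ∤ a)
coprime[2*p]⇔ {p} {a} p-prime = mk⇔ to from
  where
  to : Coprime a (2 * p) → 2 ∤ a × p ∤ a
  to a⊥2p = (λ 2∣a → contradiction (a⊥2p (2∣a , m∣m*n p)) λ ())
          , (λ p∣a → ¬prime[1] (subst Prime (a⊥2p (p∣a , n∣m*n 2)) p-prime))
  from : 2 ∤ a × p ∤ a → Coprime a (2 * p)
  from (2∤a , p∤a) {d} (d∣a , d∣2p) with prime⇒irreducible p-prime (coprime-divisor d⊥2 d∣2p)
    where
    d⊥2 : Coprime d 2
    d⊥2 {e} (e∣d , e∣2) with irreducible[2] e∣2
    ... | inj₁ e≡1  = e≡1
    ... | inj₂ refl = contradiction (∣-trans e∣d d∣a) 2∤a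
  ... | inj₁ d≡1  = d≡1
  ... | inj₂ refl = contradiction d∣a p∤a

isUnitMod[2*p]⇔ : ∀ {p a} → Prime p → IsUnitMod (2 * p) a ⇔ (2 ∤ a × p ∤ a)
isUnitMod[2*p]⇔ {p} p-prime = coprime[2*p]⇔ p-prime ⇔-∘ mk⇔ isUnitMod⇒coprime
  (coprime⇒isUnitMod {{m*n≢0 2 p {{_}} {{prime⇒nonZero p-prime}}}})

record IsCrown (G : Graph) (n : ℕ) : Set where
  field
    index            : Fin (size G) → Fin n
    side             : Fin (size G) → Parity
    label-surjective : ∀ i s → ∃[ x ] index x ≡ i × side x ≡ s
    label-injective  : ∀ {x y} → index x ≡ index y → side x ≡ side y → x ≡ y
    adjacent⇔        : ∀ {x y} → Adj G x y ⇔ (index x ≢ index y × side x ≢ side y)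

module CrownColorings {G : Graph} {n : ℕ} (crown : IsCrown G n) where
  open IsCrown crown
  open Equivalence

  indexColoring : CompleteColoring G n
  indexColoring = record
    { color    = index
    ; onto     = λ i → let x , ix≡i , _ = label-surjective i 0ℙ in x , ix≡i
    ; proper   = λ x y adj → proj₁ (to adjacent⇔ adj)
    ; complete = complete
    }
    where
    complete : ∀ i j → i ≢ j → ∃[ x ] ∃[ y ] (index x ≡ i × index y ≡ j × Adj G x y)
    complete i j i≢j with label-surjective i 0ℙ | label-surjective j 1ℙ
    ... | x , refl , x∈0 | y , refl , y∈1 =
      x , y , refl , refl , from adjacent⇔ (i≢j , subst₂ _≢_ (sym x∈0) (sym y∈1) λ ())

  module _ {m : ℕ} (c : CompleteColoring G m) where
    open CompleteColoring c

    OneSided : Fin m → Parity → Set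
    OneSided k s = ∀ x → color x ≡ k → side x ≡ s

    oneSided-unique : ∀ {k l s} → OneSided k s → OneSided l s → k ≡ l
    oneSided-unique {k} {l} k⊆s l⊆s with k Fin.≟ l
    ... | yes k≡l = k≡l
    ... | no k≢l =
      let x , y , cx≡k , cy≡l , adj = complete k l k≢l in
      contradiction (trans (k⊆s x cx≡k) (sym (l⊆s y cy≡l))) (proj₂ (to adjacent⇔ adj))

    oneSided-≢ : ∀ {k l} → OneSided k 0ℙ → OneSided l 1ℙ → k ≢ l
    oneSided-≢ {k} k⊆0 l⊆1 refl = let x , cx≡k = onto k in
      contradiction (trans (sym (k⊆0 x cx≡k)) (l⊆1 x cx≡k)) λ ()

    twin-oneSided : ∀ {x y k} → color x ≡ k → color y ≢ k → index x ≡ index y → side x ≢ side y →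
                    OneSided k (side x)
    twin-oneSided {x} {y} {k} cx≡k cy≢k ix≡iy sx≢sy z cz≡k
      with side z ℙ.≟ side x | index z Fin.≟ index x
    ... | yes sz≡sx | _ = sz≡sx
    ... | no sz≢sx | no iz≢ix =
      contradiction (trans cz≡k (sym cx≡k)) (proper z x (from adjacent⇔ (iz≢ix , sz≢sx)))
    ... | no sz≢sx | yes iz≡ix = contradiction (subst (λ v → color v ≡ k) z≡y cz≡k) cy≢k
      where
      z≡y : z ≡ y
      z≡y = label-injective (trans iz≡ix ix≡iy) (trans (≢⇒≡⁻¹ sz≢sx) (sym (≢⇒≡⁻¹ (sx≢sy ∘ sym))))

    IsTransversal : (Fin m → Fin (size G)) → Set
    IsTransversal ρ = ∀ k → color (ρ k) ≡ k

    Collision : (Fin m → Fin (size G)) → Set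
    Collision ρ = ∃₂ λ k l → OneSided k 0ℙ × OneSided l 1ℙ × index (ρ k) ≡ index (ρ l)

    collision : n < m → ∀ ρ → IsTransversal ρ → Collision ρ
    collision n<m ρ ρ-tr with pigeonhole n<m (index ∘ ρ)
    ... | k , l , k<l , ik≡il = orient (side (ρ k)) (side (ρ l)) sk≢sl
        (twin-oneSided (ρ-tr k) (λ cl≡k → k≢l (trans (sym cl≡k) (ρ-tr l))) ik≡il sk≢sl)
        (twin-oneSided (ρ-tr l) (λ ck≡l → k≢l (trans (sym (ρ-tr k)) ck≡l)) (sym ik≡il) (sk≢sl ∘ sym))
      where
      k≢l : k ≢ l
      k≢l = Fin.<⇒≢ k<l
      sk≢sl : side (ρ k) ≢ side (ρ l)
      sk≢sl sk≡sl =
        k≢l (trans (sym (ρ-tr k)) (trans (cong color (label-injective ik≡il sk≡sl)) (ρ-tr l)))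
      orient : ∀ s t → s ≢ t → OneSided k s → OneSided l t → Collision ρ
      orient 0ℙ 0ℙ s≢t _ _ = contradiction refl s≢t
      orient 0ℙ 1ℙ _ k⊆s l⊆t = k , l , k⊆s , l⊆t , ik≡il
      orient 1ℙ 0ℙ _ k⊆s l⊆t = l , k , l⊆t , k⊆s , sym ik≡il
      orient 1ℙ 1ℙ s≢t _ _ = contradiction refl s≢t

    transversal-through : ∀ {k l x y} → k ≢ l → color x ≡ k → color y ≡ l →
                          ∃[ ρ ] IsTransversal ρ × ρ k ≡ x × ρ l ≡ y
    transversal-through {k} {l} {x} {y} k≢l cx≡k cy≡l = ρ , ρ-tr , ρk≡x , ρl≡y
      where
      pick : ∀ j → Dec (j ≡ k) → Dec (j ≡ l) → Fin (size G)
      pick j (yes _) _       = x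
      pick j (no _)  (yes _) = y
      pick j (no _)  (no _)  = proj₁ (onto j)
      ρ : Fin m → Fin (size G)
      ρ j = pick j (j Fin.≟ k) (j Fin.≟ l)
      pick-tr : ∀ j j≟k j≟l → color (pick j j≟k j≟l) ≡ j
      pick-tr j (yes refl) _          = cx≡k
      pick-tr j (no _)     (yes refl) = cy≡l
      pick-tr j (no _)     (no _)     = proj₂ (onto j)
      ρ-tr : IsTransversal ρ
      ρ-tr j = pick-tr j (j Fin.≟ k) (j Fin.≟ l)
      ρk≡x : ρ k ≡ x
      ρk≡x with k Fin.≟ k
      ... | yes _   = refl
      ... | no k≢k = contradiction refl k≢k
      ρl≡y : ρ l ≡ y
      ρl≡y with l Fin.≟ k | l Fin.≟ l
      ... | yes l≡k | _       = contradiction (sym l≡k) k≢l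
      ... | no _    | yes _   = refl
      ... | no _    | no l≢l = contradiction refl l≢l

    -- The second collision is again between k and l, the only one-sided classes, whose
    -- representatives are now the adjacent x and y.
    n≮colors : ¬ n < m
    n≮colors n<m with collision n<m (proj₁ ∘ onto) (proj₂ ∘ onto)
    ... | k , l , k⊆0 , l⊆1 , _ with complete k l (oneSided-≢ k⊆0 l⊆1)
    ... | x , y , cx≡k , cy≡l , adj with transversal-through (oneSided-≢ k⊆0 l⊆1) cx≡k cy≡l
    ... | ρ , ρ-tr , ρk≡x , ρl≡y with collision n<m ρ ρ-tr
    ... | k′ , l′ , k′⊆0 , l′⊆1 , ik′≡il′ = proj₁ (to adjacent⇔ adj) (begin
      index x      ≡⟨ cong index ρk≡x ⟨
      index (ρ k)  ≡⟨ cong (index ∘ ρ) (oneSided-unique k⊆0 k′⊆0) ⟩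
      index (ρ k′) ≡⟨ ik′≡il′ ⟩
      index (ρ l′) ≡⟨ cong (index ∘ ρ) (oneSided-unique l′⊆1 l⊆1) ⟩
      index (ρ l)  ≡⟨ cong index ρl≡y ⟩
      index y      ∎)
      where open ≡-Reasoning

  crown-achromaticNumber : AchromaticNumber G n
  crown-achromaticNumber = indexColoring , λ m c → ≮⇒≥ (n≮colors c)

module OddPairing (p : ℕ) (p-odd : parity p ≡ 1ℙ) where

  p>0 : p > 0
  p>0 = n≢0⇒n>0 λ p≡0 → contradiction (subst (λ q → parity q ≡ 1ℙ) p≡0 p-odd) λ ()

  data Complementary (u w : ℕ) : Set where
    sum≡p  : u + w ≡ p     → Complementary u w
    sum≡3p : u + w ≡ 3 * p → Complementary u w

  -- partner u ≡ p − u (mod 2p), the vertex matched with u.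
  partner : ℕ → ℕ
  partner u with u ≤? p
  ... | yes _ = p ∸ u
  ... | no _  = 3 * p ∸ u

  module _ {u : ℕ} (u<2p : u < 2 * p) where

    partner-complementary : Complementary u (partner u)
    partner-complementary with u ≤? p
    ... | yes u≤p = sum≡p (m+[n∸m]≡n u≤p)
    ... | no _    = sum≡3p (m+[n∸m]≡n (≤-trans (<⇒≤ u<2p) (m≤n+m (2 * p) p)))

    partner-< : partner u < 2 * p
    partner-< with u ≤? p
    ... | yes _   = ≤-<-trans (m∸n≤m p u) (m<m+n p (+-monoˡ-< 0 p>0))
    ... | no u≰p = subst (3 * p ∸ u <_) (m+n∸m≡n p (2 * p))
                     (∸-monoʳ-< (≰⇒> u≰p) (≤-trans (<⇒≤ u<2p) (m≤n+m (2 * p) p)))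

    complementary⇒≡partner : ∀ {w} → w < 2 * p → Complementary u w → w ≡ partner u
    complementary⇒≡partner {w} w<2p u+w≡ with u ≤? p | u+w≡
    ... | yes _   | sum≡p u+w≡p   = sym (trans (cong (_∸ u) (sym u+w≡p)) (m+n∸m≡n u w))
    ... | no _    | sum≡3p u+w≡3p = sym (trans (cong (_∸ u) (sym u+w≡3p)) (m+n∸m≡n u w))
    ... | yes u≤p | sum≡3p u+w≡3p = contradiction u+w≡3p (<⇒≢ (+-mono-≤-< u≤p w<2p))
    ... | no u≰p  | sum≡p u+w≡p   = contradiction (subst (u ≤_) u+w≡p (m≤m+n u w)) u≰p

  complementary-sym : ∀ {u w} → Complementary u w → Complementary w u
  complementary-sym {u} {w} (sum≡p u+w≡p)   = sum≡p (trans (+-comm w u) u+w≡p)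
  complementary-sym {u} {w} (sum≡3p u+w≡3p) = sum≡3p (trans (+-comm w u) u+w≡3p)

  complementary⇒odd : ∀ {u w} → Complementary u w → parity (u + w) ≡ 1ℙ
  complementary⇒odd (sum≡p u+w≡p)   = trans (cong parity u+w≡p) p-odd
  complementary⇒odd (sum≡3p u+w≡3p) = trans (cong parity u+w≡3p) (trans (*-homo-* 3 p) p-odd)

  complementary⇒p∣ : ∀ {u w} → Complementary u w → p ∣ u + w
  complementary⇒p∣ (sum≡p u+w≡p)   = divides 1 (trans u+w≡p (sym (*-identityˡ p)))
  complementary⇒p∣ (sum≡3p u+w≡3p) = divides 3 u+w≡3p

  p∣⇒complementary : ∀ {u w} → u < 2 * p → w < 2 * p → parity (u + w) ≡ 1ℙ → p ∣ u + w →
                     Complementary u w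
  p∣⇒complementary {u} {w} u<2p w<2p odd (divides k u+w≡kp) with odd-below-4 k<4 k-odd
    where
    k<4 : k < 4
    k<4 = *-cancelʳ-< p k 4 (subst₂ _<_ u+w≡kp (sym (*-distribʳ-+ p 2 2)) (+-mono-< u<2p w<2p))
    k-odd : parity k ≡ 1ℙ
    k-odd = begin
      parity k              ≡⟨ ℙ.*-identityʳ (parity k) ⟨
      parity k ℙ.* 1ℙ       ≡⟨ cong (parity k ℙ.*_) p-odd ⟨
      parity k ℙ.* parity p ≡⟨ *-homo-* k p ⟨
      parity (k * p)        ≡⟨ cong parity u+w≡kp ⟨
      parity (u + w)        ≡⟨ odd ⟩
      1ℙ                    ∎
      where open ≡-Reasoning
  ... | inj₁ refl = sum≡p (trans u+w≡kp (*-identityˡ p))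
  ... | inj₂ refl = sum≡3p u+w≡kp

  module _ {u : ℕ} (u<2p : u < 2 * p) where

    partner-involutive : partner (partner u) ≡ u
    partner-involutive = sym (complementary⇒≡partner (partner-< u<2p) u<2p
                                (complementary-sym (partner-complementary u<2p)))

    parity-partner : parity (partner u) ≡ parity u ⁻¹
    parity-partner = ≢⇒≡⁻¹ λ eq → Equivalence.to +≡1ℙ⇔≢
      (trans (sym (+-homo-+ u (partner u))) (complementary⇒odd (partner-complementary u<2p))) (sym eq)

  evenMember : ℕ → ℕ
  evenMember u with parity u
  ... | 0ℙ = u
  ... | 1ℙ = partner u

  evenMember-fixes-even : ∀ {u} → parity u ≡ 0ℙ → evenMember u ≡ u
  evenMember-fixes-even even rewrite even = refl

  module _ {u : ℕ} (u<2p : u < 2 * p) where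

    evenMember-even : parity (evenMember u) ≡ 0ℙ
    evenMember-even with parity u in pu
    ... | 0ℙ = pu
    ... | 1ℙ = trans (parity-partner u<2p) (cong _⁻¹ pu)

    evenMember-< : evenMember u < 2 * p
    evenMember-< with parity u
    ... | 0ℙ = u<2p
    ... | 1ℙ = partner-< u<2p

    evenMember-partner : evenMember (partner u) ≡ evenMember u
    evenMember-partner with parity u in pu | parity (partner u) in ppu
    ... | 0ℙ | 1ℙ = partner-involutive u<2p
    ... | 1ℙ | 0ℙ = refl
    ... | 0ℙ | 0ℙ = contradiction (trans (sym ppu) (trans (parity-partner u<2p) (cong _⁻¹ pu))) λ ()
    ... | 1ℙ | 1ℙ = contradiction (trans (sym ppu) (trans (parity-partner u<2p) (cong _⁻¹ pu))) λ ()

    evenMember-≡ : ∀ {w} → w < 2 * p → evenMember u ≡ evenMember w → w ≡ u ⊎ w ≡ partner u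
    evenMember-≡ {w} w<2p eq with parity u | parity w
    ... | 0ℙ | 0ℙ = inj₁ (sym eq)
    ... | 0ℙ | 1ℙ = inj₂ (trans (sym (partner-involutive w<2p)) (cong partner (sym eq)))
    ... | 1ℙ | 0ℙ = inj₂ (sym eq)
    ... | 1ℙ | 1ℙ = inj₁ (trans (sym (partner-involutive w<2p))
                               (trans (cong partner (sym eq)) (partner-involutive u<2p)))

  pairIndex : ℕ → ℕ
  pairIndex u = ⌊ evenMember u /2⌋

  module _ {u : ℕ} (u<2p : u < 2 * p) where

    pairIndex-< : pairIndex u < p
    pairIndex-< = *-cancelʳ-< 2 (pairIndex u) p (subst₂ _<_
      (parity≡0ℙ⇒n≡⌊n/2⌋*2 (evenMember u) (evenMember-even u<2p)) (*-comm 2 p) (evenMember-< u<2p))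

    pairIndex-partner : pairIndex (partner u) ≡ pairIndex u
    pairIndex-partner = cong ⌊_/2⌋ (evenMember-partner u<2p)

    pairIndex-≡ : ∀ {w} → w < 2 * p → pairIndex u ≡ pairIndex w → w ≡ u ⊎ w ≡ partner u
    pairIndex-≡ {w} w<2p eq = evenMember-≡ u<2p w<2p (begin
      evenMember u    ≡⟨ parity≡0ℙ⇒n≡⌊n/2⌋*2 (evenMember u) (evenMember-even u<2p) ⟩
      pairIndex u * 2 ≡⟨ cong (_* 2) eq ⟩
      pairIndex w * 2 ≡⟨ parity≡0ℙ⇒n≡⌊n/2⌋*2 (evenMember w) (evenMember-even w<2p) ⟨
      evenMember w    ∎)
      where open ≡-Reasoning

    pairIndex-injective : ∀ {w} → w < 2 * p → pairIndex u ≡ pairIndex w → parity u ≡ parity w → u ≡ w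
    pairIndex-injective w<2p eq pu≡pw with pairIndex-≡ w<2p eq
    ... | inj₁ w≡u  = sym w≡u
    ... | inj₂ refl = contradiction (trans pu≡pw (parity-partner u<2p)) (p≢p⁻¹ (parity u))

    p∣⇔pairIndex≡ : ∀ {w} → w < 2 * p → parity u ≢ parity w → p ∣ u + w ⇔ pairIndex u ≡ pairIndex w
    p∣⇔pairIndex≡ {w} w<2p pu≢pw = mk⇔ to from
      where
      odd : parity (u + w) ≡ 1ℙ
      odd = trans (+-homo-+ u w) (Equivalence.from +≡1ℙ⇔≢ pu≢pw)
      to : p ∣ u + w → pairIndex u ≡ pairIndex w
      to p∣u+w = trans (sym pairIndex-partner)
        (cong pairIndex (sym (complementary⇒≡partner u<2p w<2p (p∣⇒complementary u<2p w<2p odd p∣u+w))))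
      from : pairIndex u ≡ pairIndex w → p ∣ u + w
      from eq with pairIndex-≡ w<2p eq
      ... | inj₁ refl = contradiction refl pu≢pw
      ... | inj₂ refl = complementary⇒p∣ (partner-complementary u<2p)

  pairIndex-surjective : ∀ {i} → i < p → ∀ s → ∃[ u ] u < 2 * p × pairIndex u ≡ i × parity u ≡ s
  pairIndex-surjective {i} i<p 0ℙ = i * 2 , 2i<2p , pairIndex-double , parity[n*2]≡0ℙ i
    where
    2i<2p : i * 2 < 2 * p
    2i<2p = subst (i * 2 <_) (*-comm p 2) (*-monoˡ-< 2 i<p)
    pairIndex-double : pairIndex (i * 2) ≡ i
    pairIndex-double = trans (cong ⌊_/2⌋ (evenMember-fixes-even (parity[n*2]≡0ℙ i))) (⌊n*2/2⌋≡n i)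
  pairIndex-surjective {i} i<p 1ℙ with pairIndex-surjective i<p 0ℙ
  ... | u , u<2p , iu≡i , even = partner u , partner-< u<2p , trans (pairIndex-partner u<2p) iu≡i ,
                                 trans (parity-partner u<2p) (cong _⁻¹ even)

prime∧≢2⇒parity≡1ℙ : ∀ {p} → Prime p → p ≢ 2 → parity p ≡ 1ℙ
prime∧≢2⇒parity≡1ℙ p-prime p≢2 = ≢⇒≡⁻¹ λ even →
  case prime⇒irreducible p-prime (parity≡0ℙ⇒2∣ even) of λ where
    (inj₁ ())
    (inj₂ 2≡p) → p≢2 (sym 2≡p)

unitaryAdditionCayley[2*p]-isCrown : ∀ {p} → Prime p → p ≢ 2 →
                                     IsCrown (unitaryAdditionCayley (2 * p)) p
unitaryAdditionCayley[2*p]-isCrown {p} p-prime p≢2 = record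
  { index            = index
  ; side             = side
  ; label-surjective = label-surjective
  ; label-injective  = λ {x} {y} ix≡iy sx≡sy →
      toℕ-injective (pairIndex-injective (toℕ<n x) (toℕ<n y) (from (index≡⇔ x y) ix≡iy) sx≡sy)
  ; adjacent⇔        = adjacent⇔
  }
  where
  open OddPairing p (prime∧≢2⇒parity≡1ℙ p-prime p≢2)
  open Equivalence

  V : Set
  V = Fin (2 * p)

  index : V → Fin p
  index x = fromℕ< (pairIndex-< (toℕ<n x))

  side : V → Parity
  side x = parity (toℕ x)

  index≡⇔ : ∀ x y → pairIndex (toℕ x) ≡ pairIndex (toℕ y) ⇔ index x ≡ index y
  index≡⇔ _ _ = mk⇔ (λ eq → toℕ-injective (trans (toℕ-fromℕ< _) (trans eq (sym (toℕ-fromℕ< _)))))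
                    (λ eq → trans (sym (toℕ-fromℕ< _)) (trans (cong toℕ eq) (toℕ-fromℕ< _)))

  label-surjective : ∀ i s → ∃[ x ] index x ≡ i × side x ≡ s
  label-surjective i s with pairIndex-surjective (toℕ<n i) s
  ... | u , u<2p , iu≡i , pu≡s = fromℕ< u<2p
    , toℕ-injective (trans (toℕ-fromℕ< _) (trans (cong pairIndex (toℕ-fromℕ< u<2p)) iu≡i))
    , trans (cong parity (toℕ-fromℕ< u<2p)) pu≡s

  adjacent⇔ : ∀ {x y} →
              Adj (unitaryAdditionCayley (2 * p)) x y ⇔ (index x ≢ index y × side x ≢ side y)
  adjacent⇔ {x} {y} = mk⇔ adj⇒ ⇒adj
    where
    unit⇔ : IsUnitMod (2 * p) (toℕ x + toℕ y) ⇔ (2 ∤ toℕ x + toℕ y × p ∤ toℕ x + toℕ y)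
    unit⇔ = isUnitMod[2*p]⇔ p-prime
    2∤⇔ : 2 ∤ toℕ x + toℕ y ⇔ side x ≢ side y
    2∤⇔ = 2∤[m+n]⇔parity≢ {toℕ x} {toℕ y}
    p∣⇔ : side x ≢ side y → p ∣ toℕ x + toℕ y ⇔ index x ≡ index y
    p∣⇔ sx≢sy = index≡⇔ x y ⇔-∘ p∣⇔pairIndex≡ (toℕ<n x) (toℕ<n y) sx≢sy
    adj⇒ : Adj (unitaryAdditionCayley (2 * p)) x y → index x ≢ index y × side x ≢ side y
    adj⇒ (_ , unit) = let 2∤x+y , p∤x+y = to unit⇔ unit; sx≢sy = to 2∤⇔ 2∤x+y in
      p∤x+y ∘ from (p∣⇔ sx≢sy) , sx≢sy
    ⇒adj : index x ≢ index y × side x ≢ side y → Adj (unitaryAdditionCayley (2 * p)) x y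
    ⇒adj (ix≢iy , sx≢sy) = sx≢sy ∘ cong side , from unit⇔ (from 2∤⇔ sx≢sy , ix≢iy ∘ to (p∣⇔ sx≢sy))

mainTheorem5 : ∀ (p : ℕ) → Prime p → p ≢ 2 →
    AchromaticNumber (unitaryAdditionCayley (2 * p)) p
mainTheorem5 p p-prime p≢2 =
  CrownColorings.crown-achromaticNumber (unitaryAdditionCayley[2*p]-isCrown p-prime p≢2)
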